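{- Let $K_n$ be the complete graph on $n$ nodes. For $1\le i\le n$, the number $f_{i-1}$ of $(i-1)$-dimensional faces of the discrete Morse complex $\mathfrak{M}(K_n)$ is $$f_{i-1}=\binom{n}{i}(n-i)\,n^{i-1}.$$
   Context: For a finite simplicial complex $\Delta$, its Hasse diagram is the graph whose vertices are the nonempty faces of $\Delta$, with an edge $\{f,g\}$ whenever $f\subset g$ and $\dim g=\dim f+1$. A matching $M$ of the Hasse diagram is acyclic if orienting every edge from the larger face to the smaller one, except edges of $M$ which are oriented from smaller to larger, yields a directed graph without directed cycles. The discrete Morse complex $\mathfrak{M}(\Delta)$ is the simplicial complex whose vertex set is the set of edges of the Hasse diagram of $\Delta$ and whose faces are the subsets of edges forming acyclic matchings. A graph is regarded as a one-dimensional simplicial complex. An $(i-1)$-dimensional face has $i$ vertices. -}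

module Defs where

open import Data.Nat using (ℕ; _+_)
open import Data.Bool using (Bool; true; false)
open import Data.Fin using (Fin)
open import Data.Fin.Subset using (Subset; ⁅_⁆; _∪_; ∣_∣)
open import Data.Vec using (Vec; lookup; map; sum)
open import Data.Product using (_×_; _,_)
open import Data.Sum using (_⊎_)
open import Relation.Nullary using (¬_)
open import Relation.Binary.PropositionalEquality using (_≡_; _≢_)
open import Relation.Binary.Construct.Closure.Transitive using (TransClosure)

-- The complete graph K_n as a 1-dimensional simplicial complex on the vertex
-- set Fin n: its nonempty faces are the singletons ⁅ v ⁆ and the pairs
-- ⁅ v ⁆ ∪ ⁅ u ⁆ with v ≢ u.
Face : ℕ → Set
Face n = Subset n

-- Edges of the Hasse diagram of K_n: {⁅v⁆, ⁅v⁆ ∪ ⁅u⁆} for v ≢ u.  Such an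
-- edge is determined by the ordered pair (v , u) with v ≢ u.
HasseEdge : ℕ → Set
HasseEdge n = Fin n × Fin n

IsHasseEdge : ∀ {n} → HasseEdge n → Set
IsHasseEdge (v , u) = v ≢ u

lowFace : ∀ {n} → HasseEdge n → Face n
lowFace (v , u) = ⁅ v ⁆

highFace : ∀ {n} → HasseEdge n → Face n
highFace (v , u) = ⁅ v ⁆ ∪ ⁅ u ⁆

-- A set of Hasse edges of K_n, encoded canonically as an n×n Boolean matrix:
-- entry (v , u) is true iff the Hasse edge (v , u) belongs to the set.
-- (Diagonal entries do not correspond to Hasse edges and must be false.)
EdgeSet : ℕ → Set
EdgeSet n = Vec (Vec Bool n) n

_∈E_ : ∀ {n} → HasseEdge n → EdgeSet n → Set
(v , u) ∈E M = lookup (lookup M v) u ≡ true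

_∉E_ : ∀ {n} → HasseEdge n → EdgeSet n → Set
(v , u) ∉E M = lookup (lookup M v) u ≡ false

size : ∀ {n} → EdgeSet n → ℕ
size M = sum (map ∣_∣ M)

IsMatching : ∀ {n} → EdgeSet n → Set
IsMatching {n} M =
  (∀ (e : HasseEdge n) → e ∈E M → IsHasseEdge e) ×
  (∀ (e e′ : HasseEdge n) → e ∈E M → e′ ∈E M →
     (lowFace e ≡ lowFace e′ ⊎ highFace e ≡ highFace e′ ⊎
      lowFace e ≡ highFace e′ ⊎ highFace e ≡ lowFace e′) → e ≡ e′)

data Arrow {n} (M : EdgeSet n) : Face n → Face n → Set where
  up   : ∀ (e : HasseEdge n) → IsHasseEdge e → e ∈E M → Arrow M (lowFace e) (highFace e)
  down : ∀ (e : HasseEdge n) → IsHasseEdge e → e ∉E M → Arrow M (highFace e) (lowFace e)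

IsAcyclic : ∀ {n} → EdgeSet n → Set
IsAcyclic {n} M = ∀ (f : Face n) → ¬ TransClosure (Arrow M) f f

IsAcyclicMatching : ∀ {n} → EdgeSet n → Set
IsAcyclicMatching M = IsMatching M × IsAcyclic M

-- Reading a matched Hasse edge ⁅ a ⁆ ⊂ ⁅ a ⁆ ∪ ⁅ b ⁆ as a step a ↦ b turns a matching M of K_n
-- into a partial map `next` without fixed points or 2-cycles: row a of M is either ⁅ b ⁆ or empty.
-- A directed cycle of the modified Hasse diagram alternates ⁅ a ⁆ → ⁅ a ⁆ ∪ ⁅ b ⁆ → ⁅ b ⁆, so it is
-- exactly a cycle of `next`; by the pigeonhole principle this happens iff some walk of n steps never
-- runs into an empty row.  Hence the acyclic matchings with i edges are the rooted forests on n
-- vertices with i edges, the roots being the empty rows; let A i be their number.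
-- Grafting the root ρ of one tree of F onto a vertex v outside that tree (row ρ becomes ⁅ v ⁆), and
-- cutting the edge (ρ , v) of F′ (row ρ becomes empty), are inverse bijections between such triples
-- (F, v, ρ) with ∣F∣ = i and pairs (F′, edge of F′) with ∣F′∣ = i + 1.  A forest with i edges has
-- n − i roots, one of them the root of v, so A (i + 1) · (i + 1) = A i · n · (n − i − 1), and with
-- A 0 = 1 this recurrence is solved by C(n, i) (n − i) n^(i − 1).

{-# OPTIONS --safe #-}
module Submission where

open import Defs
open import Data.Bool using (Bool; true; false)
import Data.Bool.Properties as Bool
open import Data.Empty using (⊥-elim)
open import Data.Fin using (Fin; zero; suc)
import Data.Fin as Fin
import Data.Fin.Properties as Fin
open import Data.Fin.Subset using (Subset; ⁅_⁆; _∪_; ∣_∣; ⊥) renaming (_∈_ to _∈ₛ_)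
open import Data.Fin.Subset.Properties using (x∈⁅x⁆; x∈⁅y⁆⇒x≡y; x∈p∪q⁺; x∈p∪q⁻; ∪-comm; ⊆-antisym; ∣⊥∣≡0; ∣⁅x⁆∣≡1)
open import Data.List using (List; []; _∷_; _++_; length; map; filter; cartesianProduct; cartesianProductWith; tabulate; allFin)
open import Data.List.Properties using (length-++; length-++-sucʳ; length-tabulate; map-cong; map-tabulate; filter-++; filter-accept; filter-reject; filter-none; filter-≐)
open import Data.List.Membership.Propositional using (_∈_; _∉_)
open import Data.List.Membership.Propositional.Properties using (∈-∃++; ∈-++⁻; ∈-++⁺ˡ; ∈-++⁺ʳ; ∈-filter⁺; ∈-filter⁻; ∈-allFin; ∈-cartesianProductWith⁺; ∈-cartesianProduct⁺)
open import Data.List.Relation.Unary.All as All using (All; []; _∷_)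
open import Data.List.Relation.Unary.All.Properties using (All¬⇒¬Any)
open import Data.List.Relation.Unary.Any using (here; there)
open import Data.List.Relation.Unary.Unique.Propositional using (Unique; []; _∷_)
import Data.List.Relation.Unary.Unique.Propositional.Properties as Unique
open import Data.Maybe using (Maybe; just; nothing; _>>=_)
import Data.Maybe as Maybe
import Data.Maybe.Properties as Maybe
open import Data.Nat using (ℕ; zero; suc; _+_; _*_; _∸_; _^_; _≤_; _<_; z≤n; s≤s; _≟_; _≤?_)
open import Data.Nat.Properties
open import Data.Nat.Combinatorics using (_C_; nC1≡n; k>n⇒nCk≡0; nCk+nC[k+1]≡[n+1]C[k+1])
open import Data.Nat.ListAction using (sum)
open import Data.Nat.Solver using (module +-*-Solver)
open import Data.Product using (Σ; ∃; ∃₂; _×_; _,_; proj₁; proj₂)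
import Data.Product.Properties as Product
open import Data.Sum using (_⊎_; inj₁; inj₂)
open import Data.Vec using (Vec; []; _∷_; lookup; replicate; _[_]≔_)
import Data.Vec as Vec
open import Data.Vec.Properties using (∷-injective; lookup-replicate; []=⇒lookup; lookup⇒[]=; lookup∘update; lookup∘update′; []≔-idempotent; []≔-lookup)
import Data.Vec.Properties as Vec
open import Function.Base using (_∘_)
open import Function.Bundles using (_⇔_; mk⇔; Equivalence)
open import Level using (0ℓ)
open import Relation.Binary.Construct.Closure.Transitive using (TransClosure; [_]; _∷_; _∷ʳ_) renaming (_++_ to _++⁺_)
open import Relation.Binary.Definitions using (DecidableEquality)
open import Relation.Binary.PropositionalEquality
open import Relation.Nullary using (¬_; Dec; yes; no; _×-dec_; _⊎-dec_; _→-dec_; ¬?)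
open import Relation.Nullary.Decidable using (map′)
open import Relation.Unary using (Pred; Decidable)

private
  variable
    A B D : Set

length-filter-++ : ∀ {P : Pred A 0ℓ} (P? : Decidable P) xs ys →
  length (filter P? (xs ++ ys)) ≡ length (filter P? xs) + length (filter P? ys)
length-filter-++ P? xs ys = trans (cong length (filter-++ P? xs ys)) (length-++ (filter P? xs))

length-filter-map : ∀ {P : Pred B 0ℓ} (P? : Decidable P) (f : A → B) xs →
  length (filter P? (map f xs)) ≡ length (filter (P? ∘ f) xs)
length-filter-map P? f [] = refl
length-filter-map P? f (x ∷ xs) with P? (f x)
... | yes _ = cong suc (length-filter-map P? f xs)
... | no _ = length-filter-map P? f xs

length-filter-cartesianProductWith : ∀ {P : Pred D 0ℓ} (P? : Decidable P) (f : A → B → D) xs ys →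
  length (filter P? (cartesianProductWith f xs ys)) ≡
  sum (map (λ x → length (filter (P? ∘ f x) ys)) xs)
length-filter-cartesianProductWith P? f [] ys = refl
length-filter-cartesianProductWith P? f (x ∷ xs) ys = begin
  length (filter P? (map (f x) ys ++ cartesianProductWith f xs ys))
    ≡⟨ length-filter-++ P? (map (f x) ys) _ ⟩
  length (filter P? (map (f x) ys)) + length (filter P? (cartesianProductWith f xs ys))
    ≡⟨ cong₂ _+_ (length-filter-map P? (f x) ys) (length-filter-cartesianProductWith P? f xs ys) ⟩
  sum (map (λ x → length (filter (P? ∘ f x) ys)) (x ∷ xs)) ∎
  where open ≡-Reasoning

sum-map-const : ∀ (c : A → ℕ) {k} xs → (∀ x → c x ≡ k) → sum (map c xs) ≡ length xs * k
sum-map-const c [] c≡k = refl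
sum-map-const c (x ∷ xs) c≡k = cong₂ _+_ (c≡k x) (sum-map-const c xs c≡k)

sum-map-indicator : ∀ {P : Pred A 0ℓ} (P? : Decidable P) (c : A → ℕ) {k} xs →
  (∀ x → P x → c x ≡ k) → (∀ x → ¬ P x → c x ≡ 0) → sum (map c xs) ≡ length (filter P? xs) * k
sum-map-indicator P? c [] c≡k c≡0 = refl
sum-map-indicator P? c (x ∷ xs) c≡k c≡0 with P? x
... | yes Px = cong₂ _+_ (c≡k x Px) (sum-map-indicator P? c xs c≡k c≡0)
... | no ¬Px = cong₂ _+_ (c≡0 x ¬Px) (sum-map-indicator P? c xs c≡k c≡0)

length-filter-cartesianProduct-× : ∀ {P : Pred A 0ℓ} {R : A → Pred B 0ℓ}
  (P? : Decidable P) (R? : ∀ x → Decidable (R x)) xs ys {k} → (∀ x → P x → length (filter (R? x) ys) ≡ k) →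
  length (filter (λ (x , y) → P? x ×-dec R? x y) (cartesianProduct xs ys)) ≡ length (filter P? xs) * k
length-filter-cartesianProduct-× P? R? xs ys count = trans
  (length-filter-cartesianProductWith (λ (x , y) → P? x ×-dec R? x y) _,_ xs ys)
  (sum-map-indicator P? _ xs
    (λ x Px → trans (cong length (filter-≐ (λ y → P? x ×-dec R? x y) (R? x) (proj₂ , (Px ,_)) ys))
                    (count x Px))
    (λ x ¬Px → cong length (filter-none (λ y → P? x ×-dec R? x y) {ys} (All.tabulate (λ _ → ¬Px ∘ proj₁)))))

length-filter+sum : ∀ {P : Pred A 0ℓ} (P? : Decidable P) (c : A → ℕ) xs →
  (∀ x → (P x × c x ≡ 0) ⊎ (¬ P x × c x ≡ 1)) → length (filter P? xs) + sum (map c xs) ≡ length xs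
length-filter+sum P? c [] split = refl
length-filter+sum P? c (x ∷ xs) split with split x
... | inj₁ (Px , cx≡0) rewrite filter-accept P? {xs = xs} Px | cx≡0 =
  cong suc (length-filter+sum P? c xs split)
... | inj₂ (¬Px , cx≡1) rewrite filter-reject P? {xs = xs} ¬Px | cx≡1 =
  trans (+-suc _ _) (cong suc (length-filter+sum P? c xs split))

module _ {P : Pred A 0ℓ} (P? : Decidable P) (_≟ᴬ_ : DecidableEquality A) where

  filter-≢-∉ : ∀ {r} xs → r ∉ xs → filter (λ x → P? x ×-dec ¬? (r ≟ᴬ x)) xs ≡ filter P? xs
  filter-≢-∉ [] r∉ = refl
  filter-≢-∉ {r} (x ∷ xs) r∉ with P? x | r ≟ᴬ x
  ... | _ | yes refl = ⊥-elim (r∉ (here refl))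
  ... | yes _ | no _ = cong (x ∷_) (filter-≢-∉ xs (r∉ ∘ there))
  ... | no _ | no _ = filter-≢-∉ xs (r∉ ∘ there)

  length-filter-≢ : ∀ {r} xs → Unique xs → r ∈ xs → P r →
    suc (length (filter (λ x → P? x ×-dec ¬? (r ≟ᴬ x)) xs)) ≡ length (filter P? xs)
  length-filter-≢ (x ∷ xs) (x∉xs ∷ _) (here refl) Px
    rewrite filter-accept P? {xs = xs} Px
          | filter-reject (λ y → P? y ×-dec ¬? (x ≟ᴬ y)) {xs = xs} (λ (_ , x≢x) → x≢x refl) =
    cong (suc ∘ length) (filter-≢-∉ xs (All¬⇒¬Any x∉xs))
  length-filter-≢ {r} (x ∷ xs) (x∉xs ∷ xs!) (there r∈xs) Pr with P? x | r ≟ᴬ x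
  ... | _ | yes refl = ⊥-elim (All.lookup x∉xs r∈xs refl)
  ... | yes _ | no _ = cong suc (length-filter-≢ xs xs! r∈xs Pr)
  ... | no _ | no _ = length-filter-≢ xs xs! r∈xs Pr

length-≤-injection : ∀ (f : A → B) xs ys → Unique xs → (∀ {x} → x ∈ xs → f x ∈ ys) →
  (∀ {x x′} → x ∈ xs → x′ ∈ xs → f x ≡ f x′ → x ≡ x′) → length xs ≤ length ys
length-≤-injection f [] ys _ _ _ = z≤n
length-≤-injection f (x ∷ xs) ys (x∉xs ∷ xs!) maps inj with ∈-∃++ (maps (here refl))
... | ys₁ , ys₂ , refl =
  ≤-trans (s≤s (length-≤-injection f xs (ys₁ ++ ys₂) xs! maps′ (λ p q → inj (there p) (there q))))
          (≤-reflexive (sym (length-++-sucʳ ys₁ (f x) ys₂)))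
  where
  maps′ : ∀ {x′} → x′ ∈ xs → f x′ ∈ ys₁ ++ ys₂
  maps′ {x′} x′∈xs with ∈-++⁻ ys₁ (maps (there x′∈xs))
  ... | inj₁ p = ∈-++⁺ˡ p
  ... | inj₂ (here fx′≡fx) =
    ⊥-elim (All.lookup x∉xs x′∈xs (sym (inj (there x′∈xs) (here refl) fx′≡fx)))
  ... | inj₂ (there p) = ∈-++⁺ʳ ys₁ p

length-≡-bijection : ∀ (f : A → B) (g : B → A) xs ys → Unique xs → Unique ys →
  (∀ {x} → x ∈ xs → f x ∈ ys) → (∀ {y} → y ∈ ys → g y ∈ xs) →
  (∀ {x} → x ∈ xs → g (f x) ≡ x) → (∀ {y} → y ∈ ys → f (g y) ≡ y) → length xs ≡ length ys
length-≡-bijection f g xs ys xs! ys! f∈ g∈ gf fg = ≤-antisym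
  (length-≤-injection f xs ys xs! f∈ (λ p q e → trans (sym (gf p)) (trans (cong g e) (gf q))))
  (length-≤-injection g ys xs ys! g∈ (λ p q e → trans (sym (fg p)) (trans (cong f e) (fg q))))

length-allFin : ∀ n → length (allFin n) ≡ n
length-allFin n = length-tabulate {n = n} (λ i → i)

allBools : List Bool
allBools = true ∷ false ∷ []

∈-allBools : ∀ b → b ∈ allBools
∈-allBools true = here refl
∈-allBools false = there (here refl)

allBools! : Unique allBools
allBools! = ((λ ()) ∷ []) ∷ [] ∷ []

allVecs : List A → ∀ m → List (Vec A m)
allVecs xs zero = [] ∷ []
allVecs xs (suc m) = cartesianProductWith _∷_ xs (allVecs xs m)

∈-allVecs : ∀ {xs : List A} → (∀ x → x ∈ xs) → ∀ {m} (v : Vec A m) → v ∈ allVecs xs m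
∈-allVecs ∈xs [] = here refl
∈-allVecs ∈xs (x ∷ v) = ∈-cartesianProductWith⁺ _∷_ (∈xs x) (∈-allVecs ∈xs v)

allVecs! : ∀ {xs : List A} → Unique xs → ∀ m → Unique (allVecs xs m)
allVecs! xs! zero = [] ∷ []
allVecs! xs! (suc m) = Unique.cartesianProductWith⁺ _∷_ ∷-injective xs! (allVecs! xs! m)

allEdgeSets : ∀ n → List (EdgeSet n)
allEdgeSets n = allVecs (allVecs allBools n) n

∈-allEdgeSets : ∀ {n} (M : EdgeSet n) → M ∈ allEdgeSets n
∈-allEdgeSets = ∈-allVecs (∈-allVecs ∈-allBools)

allEdgeSets! : ∀ n → Unique (allEdgeSets n)
allEdgeSets! n = allVecs! (allVecs! allBools! n) n

module _ {n : ℕ} where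

  ⁅⁆-injective : ∀ {a b : Fin n} → ⁅ a ⁆ ≡ ⁅ b ⁆ → a ≡ b
  ⁅⁆-injective {a} {b} eq = x∈⁅y⁆⇒x≡y b (subst (a ∈ₛ_) eq (x∈⁅x⁆ a))

  ∈-pairˡ : ∀ (a b : Fin n) → a ∈ₛ ⁅ a ⁆ ∪ ⁅ b ⁆
  ∈-pairˡ a b = x∈p∪q⁺ (inj₁ (x∈⁅x⁆ a))

  ∈-pairʳ : ∀ (a b : Fin n) → b ∈ₛ ⁅ a ⁆ ∪ ⁅ b ⁆
  ∈-pairʳ a b = x∈p∪q⁺ (inj₂ (x∈⁅x⁆ b))

  ∈-pair⁻ : ∀ {x} (a b : Fin n) → x ∈ₛ ⁅ a ⁆ ∪ ⁅ b ⁆ → x ≡ a ⊎ x ≡ b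
  ∈-pair⁻ a b x∈ with x∈p∪q⁻ ⁅ a ⁆ ⁅ b ⁆ x∈
  ... | inj₁ x∈a = inj₁ (x∈⁅y⁆⇒x≡y a x∈a)
  ... | inj₂ x∈b = inj₂ (x∈⁅y⁆⇒x≡y b x∈b)

  pair≢singleton : ∀ {a b c : Fin n} → a ≢ b → ⁅ a ⁆ ∪ ⁅ b ⁆ ≢ ⁅ c ⁆
  pair≢singleton {a} {b} {c} a≢b eq = a≢b (trans (a≡c (∈-pairˡ a b)) (sym (a≡c (∈-pairʳ a b))))
    where
    a≡c : ∀ {x} → x ∈ₛ ⁅ a ⁆ ∪ ⁅ b ⁆ → x ≡ c
    a≡c {x} x∈ab = x∈⁅y⁆⇒x≡y c (subst (x ∈ₛ_) eq x∈ab)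

  pair-injective : ∀ {a b c d : Fin n} → c ≢ d → ⁅ a ⁆ ∪ ⁅ b ⁆ ≡ ⁅ c ⁆ ∪ ⁅ d ⁆ →
    (a ≡ c × b ≡ d) ⊎ (a ≡ d × b ≡ c)
  pair-injective {a} {b} {c} {d} c≢d eq
    with ∈-pair⁻ c d (subst (a ∈ₛ_) eq (∈-pairˡ a b))
  ... | inj₁ refl with ∈-pair⁻ a b (subst (d ∈ₛ_) (sym eq) (∈-pairʳ c d))
  ...   | inj₁ refl = ⊥-elim (c≢d refl)
  ...   | inj₂ refl = inj₁ (refl , refl)
  pair-injective {a} {b} {c} {d} c≢d eq
      | inj₂ refl with ∈-pair⁻ a b (subst (c ∈ₛ_) (sym eq) (∈-pairˡ c d))
  ...   | inj₁ refl = ⊥-elim (c≢d refl)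
  ...   | inj₂ refl = inj₂ (refl , refl)

module Matching {n : ℕ} {M : EdgeSet n} (M-matching : IsMatching M) where

  irreflexive : ∀ {a b} → (a , b) ∈E M → a ≢ b
  irreflexive ab∈M = proj₁ M-matching _ ab∈M

  functional : ∀ {a b c} → (a , b) ∈E M → (a , c) ∈E M → b ≡ c
  functional ab∈M ac∈M = cong proj₂ (proj₂ M-matching _ _ ab∈M ac∈M (inj₁ refl))

  asymmetric : ∀ {a b} → (a , b) ∈E M → ¬ (b , a) ∈E M
  asymmetric {a} {b} ab∈M ba∈M =
    irreflexive ab∈M (cong proj₁ (proj₂ M-matching _ _ ab∈M ba∈M (inj₂ (inj₁ (∪-comm ⁅ a ⁆ ⁅ b ⁆)))))

  row≡⁅⁆ : ∀ {a b} → (a , b) ∈E M → lookup M a ≡ ⁅ b ⁆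
  row≡⁅⁆ {a} {b} ab∈M = ⊆-antisym
    (λ {x} x∈row → subst (_∈ₛ ⁅ b ⁆) (functional ab∈M ([]=⇒lookup x∈row)) (x∈⁅x⁆ b))
    (λ {x} x∈⁅b⁆ → subst (_∈ₛ lookup M a) (sym (x∈⁅y⁆⇒x≡y b x∈⁅b⁆)) (lookup⇒[]= b _ ab∈M))

module _ {n : ℕ} {M : EdgeSet n} where

  isMatching : (∀ {a b} → (a , b) ∈E M → a ≢ b) →
               (∀ {a b c} → (a , b) ∈E M → (a , c) ∈E M → b ≡ c) →
               (∀ {a b} → (a , b) ∈E M → ¬ (b , a) ∈E M) → IsMatching M
  isMatching irrefl functional asym = (λ _ → irrefl) , sharesNoFace
    where
    sharesNoFace : ∀ e e′ → e ∈E M → e′ ∈E M →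
      (lowFace e ≡ lowFace e′ ⊎ highFace e ≡ highFace e′ ⊎
       lowFace e ≡ highFace e′ ⊎ highFace e ≡ lowFace e′) → e ≡ e′
    sharesNoFace (a , b) (c , d) ab∈M cd∈M (inj₁ ⁅a⁆≡⁅c⁆) with ⁅⁆-injective ⁅a⁆≡⁅c⁆
    ... | refl = cong (a ,_) (functional ab∈M cd∈M)
    sharesNoFace (a , b) (c , d) ab∈M cd∈M (inj₂ (inj₁ ab≡cd)) with pair-injective (irrefl cd∈M) ab≡cd
    ... | inj₁ (refl , refl) = refl
    ... | inj₂ (refl , refl) = ⊥-elim (asym ab∈M cd∈M)
    sharesNoFace (a , b) (c , d) ab∈M cd∈M (inj₂ (inj₂ (inj₁ a≡cd))) =
      ⊥-elim (pair≢singleton (irrefl cd∈M) (sym a≡cd))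
    sharesNoFace (a , b) (c , d) ab∈M cd∈M (inj₂ (inj₂ (inj₂ ab≡c))) =
      ⊥-elim (pair≢singleton (irrefl ab∈M) ab≡c)

_∈E?_ : ∀ {n} e (M : EdgeSet n) → Dec (e ∈E M)
(a , b) ∈E? M = lookup (lookup M a) b Bool.≟ true

allPairs? : ∀ {n} {P : Pred (Fin n × Fin n) 0ℓ} → Decidable P → Dec (∀ e → P e)
allPairs? P? = map′ (λ ∀P (a , b) → ∀P a b) (λ ∀P a b → ∀P (a , b))
  (Fin.all? (λ a → Fin.all? (λ b → P? (a , b))))

isMatching? : ∀ {n} → Decidable (IsMatching {n})
isMatching? M = allPairs? (λ e → (e ∈E? M) →-dec ¬? (proj₁ e Fin.≟ proj₂ e)) ×-dec
  allPairs? (λ e → allPairs? (λ e′ → (e ∈E? M) →-dec (e′ ∈E? M) →-dec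
    (((lowFace e ≟ₛ lowFace e′) ⊎-dec (highFace e ≟ₛ highFace e′) ⊎-dec
      (lowFace e ≟ₛ highFace e′) ⊎-dec (highFace e ≟ₛ lowFace e′)) →-dec
      (Product.≡-dec Fin._≟_ Fin._≟_ e e′))))
  where
  _≟ₛ_ : ∀ {m} → DecidableEquality (Subset m)
  _≟ₛ_ = Vec.≡-dec Bool._≟_

firstTrue : ∀ {m} → Vec Bool m → Maybe (Fin m)
firstTrue [] = nothing
firstTrue (true ∷ p) = just zero
firstTrue (false ∷ p) = Maybe.map suc (firstTrue p)

firstTrue-sound : ∀ {m} (p : Vec Bool m) {u} → firstTrue p ≡ just u → lookup p u ≡ true
firstTrue-sound (true ∷ p) refl = refl
firstTrue-sound (false ∷ p) eq with firstTrue p in eq′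
... | just _ with refl ← eq = firstTrue-sound p eq′

firstTrue-just : ∀ {m} (p : Vec Bool m) {u} → lookup p u ≡ true → ∃ λ u′ → firstTrue p ≡ just u′
firstTrue-just (true ∷ p) _ = zero , refl
firstTrue-just (false ∷ p) {suc u} pu≡true with firstTrue-just p pu≡true
... | u′ , eq = suc u′ , cong (Maybe.map suc) eq

firstTrue-⊥ : ∀ m → firstTrue (⊥ {m}) ≡ nothing
firstTrue-⊥ zero = refl
firstTrue-⊥ (suc m) = cong (Maybe.map suc) (firstTrue-⊥ m)

firstTrue≡nothing⇒≡⊥ : ∀ {m} (p : Vec Bool m) → firstTrue p ≡ nothing → p ≡ ⊥
firstTrue≡nothing⇒≡⊥ [] _ = refl
firstTrue≡nothing⇒≡⊥ (false ∷ p) eq with firstTrue p in eq′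
... | nothing = cong (false ∷_) (firstTrue≡nothing⇒≡⊥ p eq′)

firstTrue-⁅⁆ : ∀ {m} (v : Fin m) → firstTrue ⁅ v ⁆ ≡ just v
firstTrue-⁅⁆ zero = refl
firstTrue-⁅⁆ (suc v) = cong (Maybe.map suc) (firstTrue-⁅⁆ v)

module _ {n : ℕ} (M : EdgeSet n) where

  next : Fin n → Maybe (Fin n)
  next a = firstTrue (lookup M a)

  next-sound : ∀ {a b} → next a ≡ just b → (a , b) ∈E M
  next-sound = firstTrue-sound (lookup M _)

  next-complete : IsMatching M → ∀ {a b} → (a , b) ∈E M → next a ≡ just b
  next-complete M-matching ab∈M with firstTrue-just (lookup M _) ab∈M
  ... | b′ , eq = trans eq (cong just (Matching.functional {M = M} M-matching (next-sound eq) ab∈M))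

  walk : ℕ → Maybe (Fin n) → Maybe (Fin n)
  walk zero x = x
  walk (suc k) x = walk k (x >>= next)

  walk-nothing : ∀ k → walk k nothing ≡ nothing
  walk-nothing zero = refl
  walk-nothing (suc k) = walk-nothing k

  walk-+ : ∀ j k x → walk (j + k) x ≡ walk k (walk j x)
  walk-+ zero k x = refl
  walk-+ (suc j) k x = walk-+ j k (x >>= next)

  walk-extend : ∀ {j x} k → walk j x ≡ nothing → walk (j + k) x ≡ nothing
  walk-extend {j} {x} k eq = trans (walk-+ j k x) (trans (cong (walk k) eq) (walk-nothing k))

  walk-periodic : ∀ {p x} → walk p x ≡ x → ∀ j → walk (j * p) x ≡ x
  walk-periodic eq zero = refl
  walk-periodic {p} {x} eq (suc j) =
    trans (walk-+ p (j * p) x) (trans (cong (walk (j * p)) eq) (walk-periodic eq j))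

  walk-periodic⇒non-terminating : ∀ {a} p → walk (suc p) (just a) ≡ just a →
    ∀ k → walk k (just a) ≢ nothing
  walk-periodic⇒non-terminating {a} p periodic k stops = just≢nothing (begin
    just a                       ≡⟨ walk-periodic {suc p} {just a} periodic k ⟨
    walk (k * suc p) (just a)    ≡⟨ cong (λ m → walk m (just a)) (*-suc k p) ⟩
    walk (k + k * p) (just a)    ≡⟨ walk-extend {k} {just a} (k * p) stops ⟩
    nothing                      ∎)
    where
    open ≡-Reasoning
    just≢nothing : just a ≢ nothing
    just≢nothing ()

  walk-just-≤ : ∀ {j k x z} → j ≤ k → walk k x ≡ just z → ∃ λ y → walk j x ≡ just y
  walk-just-≤ {j} {k} {x} j≤k eq with walk j x in eq′
  ... | just y = y , refl
  ... | nothing with () ← trans (sym eq) (trans (cong (λ m → walk m x) (sym (m+[n∸m]≡n j≤k)))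
                                                 (walk-extend {j} {x} (k ∸ j) eq′))

  walk-repeat : ∀ {i j x y} → i < j → walk i x ≡ just y → walk j x ≡ just y →
    ∃ λ o → walk (suc o) (just y) ≡ just y
  walk-repeat {i} {j} {x} {y} i<j eqᵢ eqⱼ with o , refl ← m≤n⇒∃[o]m+o≡n i<j = o , (begin
    walk (suc o) (just y)        ≡⟨ cong (walk (suc o)) eqᵢ ⟨
    walk (suc o) (walk i x)      ≡⟨ walk-+ i (suc o) x ⟨
    walk (i + suc o) x           ≡⟨ cong (λ m → walk m x) (+-suc i o) ⟩
    walk (suc i + o) x           ≡⟨ eqⱼ ⟩
    just y                       ∎)
    where open ≡-Reasoning

-- Acyclic matchings are the matchings whose walks terminate

module _ {n : ℕ} {M : EdgeSet n} where

  arrow-irreflexive : ∀ {S T} → Arrow M S T → S ≢ T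
  arrow-irreflexive (up _ v≢u _) eq = pair≢singleton v≢u (sym eq)
  arrow-irreflexive (down _ v≢u _) eq = pair≢singleton v≢u eq

  arrow-from-singleton : ∀ {S T a} → Arrow M S T → S ≡ ⁅ a ⁆ →
    ∃ λ b → (a , b) ∈E M × T ≡ ⁅ a ⁆ ∪ ⁅ b ⁆
  arrow-from-singleton (up (_ , u) _ vu∈M) eq with refl ← ⁅⁆-injective eq = u , vu∈M , refl
  arrow-from-singleton (down _ v≢u _) eq = ⊥-elim (pair≢singleton v≢u eq)

  module _ (M-matching : IsMatching M) where
    open Matching {M = M} M-matching

    arrow-from-edge : ∀ {S T a b} → (a , b) ∈E M → Arrow M S T → S ≡ ⁅ a ⁆ ∪ ⁅ b ⁆ → T ≡ ⁅ b ⁆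
    arrow-from-edge ab∈M (up _ _ _) eq = ⊥-elim (pair≢singleton (irreflexive ab∈M) (sym eq))
    arrow-from-edge ab∈M (down _ _ vu∉M) eq with pair-injective (irreflexive ab∈M) eq
    ... | inj₁ (refl , refl) = ⊥-elim (Bool.not-¬ vu∉M ab∈M)
    ... | inj₂ (refl , refl) = refl

    arrows⇒walk : ∀ {S T a c} → TransClosure (Arrow M) S T → S ≡ ⁅ a ⁆ → T ≡ ⁅ c ⁆ →
      ∃ λ k → walk M (suc k) (just a) ≡ just c
    arrows⇒walk [ r ] S≡a T≡c with b , ab∈M , T≡ab ← arrow-from-singleton r S≡a =
      ⊥-elim (pair≢singleton (irreflexive ab∈M) (trans (sym T≡ab) T≡c))
    arrows⇒walk (r ∷ [ r′ ]) S≡a T≡c with b , ab∈M , P≡ab ← arrow-from-singleton r S≡a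
      with refl ← ⁅⁆-injective (trans (sym T≡c) (arrow-from-edge ab∈M r′ P≡ab)) =
      0 , next-complete M M-matching ab∈M
    arrows⇒walk (r ∷ r′ ∷ rs) S≡a T≡c with b , ab∈M , P≡ab ← arrow-from-singleton r S≡a
      with k , eq ← arrows⇒walk rs (arrow-from-edge ab∈M r′ P≡ab) T≡c =
      suc k , trans (cong (walk M (suc k)) (next-complete M M-matching ab∈M)) eq

    arrowCycle⇒walkCycle : ∀ {S} → TransClosure (Arrow M) S S →
      ∃₂ λ a k → walk M (suc k) (just a) ≡ just a
    arrowCycle⇒walkCycle [ r ] = ⊥-elim (arrow-irreflexive r refl)
    arrowCycle⇒walkCycle c@(up (v , _) _ _ ∷ _) = v , arrows⇒walk c refl refl
    arrowCycle⇒walkCycle (r@(down (v , _) _ _) ∷ rs) = v , arrows⇒walk (rs ∷ʳ r) refl refl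

    next⇒arrows : ∀ {a b} → next M a ≡ just b → TransClosure (Arrow M) ⁅ a ⁆ ⁅ b ⁆
    next⇒arrows {a} {b} eq =
      up (a , b) a≢b ab∈M ∷
      [ subst (λ S → Arrow M S ⁅ b ⁆) (∪-comm ⁅ b ⁆ ⁅ a ⁆)
          (down (b , a) (a≢b ∘ sym) (Bool.¬-not (asymmetric ab∈M))) ]
      where
      ab∈M : (a , b) ∈E M
      ab∈M = next-sound M eq
      a≢b : a ≢ b
      a≢b = irreflexive ab∈M

    walk⇒arrows : ∀ k {a c} → walk M (suc k) (just a) ≡ just c → TransClosure (Arrow M) ⁅ a ⁆ ⁅ c ⁆
    walk⇒arrows k {a} eq with next M a in eq′
    ... | nothing with () ← trans (sym eq) (walk-nothing M k)
    walk⇒arrows zero eq | just b with refl ← eq = next⇒arrows eq′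
    walk⇒arrows (suc k) eq | just b = next⇒arrows eq′ ++⁺ walk⇒arrows k eq

Terminating : ∀ {n} → EdgeSet n → Set
Terminating M = ∀ w → ∃ λ k → walk M k (just w) ≡ nothing

module _ {n : ℕ} {M : EdgeSet n} (M-matching : IsMatching M) where

  terminating⇒acyclic : Terminating M → IsAcyclic M
  terminating⇒acyclic terminating _ cycle
    with a , p , periodic ← arrowCycle⇒walkCycle M-matching cycle
    with k , stops ← terminating a
    = walk-periodic⇒non-terminating M p periodic k stops

  acyclic⇒no-walk-cycle : IsAcyclic M → ∀ k {a} → walk M (suc k) (just a) ≢ just a
  acyclic⇒no-walk-cycle acyclic k {a} periodic = acyclic ⁅ a ⁆ (walk⇒arrows M-matching k periodic)

walk-n-repeats : ∀ {n} (M : EdgeSet n) {w z} → walk M n (just w) ≡ just z →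
  ∃₂ λ y o → walk M (suc o) (just y) ≡ just y
walk-n-repeats {n} M {w} eq = repeated (Fin.pigeonhole (n<1+n n) (proj₁ ∘ visit))
  where
  visit : (k : Fin (suc n)) → ∃ λ y → walk M (Fin.toℕ k) (just w) ≡ just y
  visit k = walk-just-≤ M (Fin.toℕ≤pred[n] k) eq
  repeated : (∃₂ λ i j → i Fin.< j × proj₁ (visit i) ≡ proj₁ (visit j)) →
    ∃₂ λ y o → walk M (suc o) (just y) ≡ just y
  repeated (i , j , i<j , same) =
    _ , walk-repeat M i<j (proj₂ (visit i)) (trans (proj₂ (visit j)) (cong just (sym same)))

acyclic⇒walk-n≡nothing : ∀ {n} {M : EdgeSet n} → IsMatching M → IsAcyclic M →
  ∀ w → walk M n (just w) ≡ nothing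
acyclic⇒walk-n≡nothing {n} {M} M-matching acyclic w with walk M n (just w) in eq
... | nothing = refl
... | just _ with _ , o , periodic ← walk-n-repeats M eq =
  ⊥-elim (acyclic⇒no-walk-cycle M-matching acyclic o periodic)

isAcyclicMatching? : ∀ {n} → Decidable (IsAcyclicMatching {n})
isAcyclicMatching? {n} M = map′
  (λ (M-matching , stops) → M-matching , terminating⇒acyclic M-matching (λ w → n , stops w))
  (λ (M-matching , acyclic) → M-matching , acyclic⇒walk-n≡nothing M-matching acyclic)
  (isMatching? M ×-dec Fin.all? (λ w → Maybe.≡-dec Fin._≟_ (walk M n (just w)) nothing))

module _ {n : ℕ} {M M′ : EdgeSet n}
         (next⊑next′ : ∀ {a b} → next M a ≡ just b → next M′ a ≡ just b) where

  walk-⊑-just : ∀ k {x y} → walk M k x ≡ just y → walk M′ k x ≡ just y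
  walk-⊑-just zero eq = eq
  walk-⊑-just (suc k) {nothing} eq with () ← trans (sym eq) (walk-nothing M k)
  walk-⊑-just (suc k) {just a} eq with next M a in eq′
  ... | nothing with () ← trans (sym eq) (walk-nothing M k)
  ... | just b rewrite next⊑next′ eq′ = walk-⊑-just k eq

  walk-⊑-nothing : ∀ k {x} → walk M′ k x ≡ nothing → walk M k x ≡ nothing
  walk-⊑-nothing zero eq = eq
  walk-⊑-nothing (suc k) {nothing} eq = walk-nothing M k
  walk-⊑-nothing (suc k) {just a} eq with next M a in eq′
  ... | nothing = walk-nothing M k
  ... | just b rewrite next⊑next′ eq′ = walk-⊑-nothing k eq

_⊆E_ : ∀ {n} → EdgeSet n → EdgeSet n → Set
M ⊆E M′ = ∀ {e} → e ∈E M → e ∈E M′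

next-⊆ : ∀ {n} {M M′ : EdgeSet n} → IsMatching M′ → M ⊆E M′ →
  ∀ {a b} → next M a ≡ just b → next M′ a ≡ just b
next-⊆ {M = M} {M′} M′-matching M⊆M′ eq = next-complete M′ M′-matching (M⊆M′ (next-sound M eq))

acyclicMatching-⊆ : ∀ {n} {M M′ : EdgeSet n} → M ⊆E M′ → IsAcyclicMatching M′ → IsAcyclicMatching M
acyclicMatching-⊆ {n} {M} {M′} M⊆M′ (M′-matching , M′-acyclic) =
  M-matching , terminating⇒acyclic M-matching (λ w → n , walk-⊑-nothing next⊑next′ n (M′-stops w))
  where
  M-matching : IsMatching M
  M-matching = (λ e → proj₁ M′-matching e ∘ M⊆M′) ,
               (λ e e′ e∈M e′∈M → proj₂ M′-matching e e′ (M⊆M′ e∈M) (M⊆M′ e′∈M))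
  next⊑next′ : ∀ {a b} → next M a ≡ just b → next M′ a ≡ just b
  next⊑next′ = next-⊆ {M = M} {M′} M′-matching M⊆M′
  M′-stops : ∀ w → walk M′ n (just w) ≡ nothing
  M′-stops = acyclic⇒walk-n≡nothing M′-matching M′-acyclic

module _ {n : ℕ} (M : EdgeSet n) where

  IsRoot : Fin n → Set
  IsRoot ρ = lookup M ρ ≡ ⊥

  isRoot? : Decidable IsRoot
  isRoot? ρ = Vec.≡-dec Bool._≟_ (lookup M ρ) ⊥

  next≡nothing⇒isRoot : ∀ {ρ} → next M ρ ≡ nothing → IsRoot ρ
  next≡nothing⇒isRoot = firstTrue≡nothing⇒≡⊥ _

  isRoot⇒next≡nothing : ∀ {ρ} → IsRoot ρ → next M ρ ≡ nothing
  isRoot⇒next≡nothing ρ-root = trans (cong firstTrue ρ-root) (firstTrue-⊥ n)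

  isRoot⇒∉E : ∀ {ρ u} → IsRoot ρ → ¬ (ρ , u) ∈E M
  isRoot⇒∉E {ρ} {u} ρ-root ρu∈M =
    Bool.not-¬ (lookup-replicate u false) (trans (cong (λ p → lookup p u) (sym ρ-root)) ρu∈M)

  follow : ℕ → Fin n → Fin n
  follow zero w = w
  follow (suc k) w = Maybe.maybe (follow k) w (next M w)

  follow-reachable : ∀ k w → ∃ λ j → walk M j (just w) ≡ just (follow k w)
  follow-reachable zero w = 0 , refl
  follow-reachable (suc k) w with next M w in eq
  ... | nothing = 0 , refl
  ... | just u with j , reach ← follow-reachable k u = suc j , trans (cong (walk M j) eq) reach

  follow-stops : ∀ k w → walk M k (just w) ≡ nothing → next M (follow k w) ≡ nothing
  follow-stops (suc k) w stops with next M w in eq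
  ... | nothing = eq
  ... | just u = follow-stops k u stops

  follow-root : ∀ j k {w ρ} → walk M j (just w) ≡ just ρ → next M ρ ≡ nothing → j ≤ k →
    follow k w ≡ ρ
  follow-root zero zero refl _ _ = refl
  follow-root zero (suc k) {w} refl stops _ rewrite stops = refl
  follow-root (suc j) (suc k) {w} reach stops (s≤s j≤k) with next M w in eq
  ... | nothing with () ← trans (sym reach) (walk-nothing M j)
  ... | just u = follow-root j k reach stops j≤k

  rootOf : Fin n → Fin n
  rootOf = follow n

  module _ {v : Fin n} (v-stops : walk M n (just v) ≡ nothing) where

    rootOf-isRoot : IsRoot (rootOf v)
    rootOf-isRoot = next≡nothing⇒isRoot (follow-stops n v v-stops)

    rootOf-unique : ∀ {j ρ} → walk M j (just v) ≡ just ρ → IsRoot ρ → rootOf v ≡ ρ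
    rootOf-unique {j} reach ρ-root with j ≤? n
    ... | yes j≤n = follow-root j n reach (isRoot⇒next≡nothing ρ-root) j≤n
    ... | no j≰n with _ , reach-n ← walk-just-≤ M (<⇒≤ (≰⇒> j≰n)) reach
      with () ← trans (sym reach-n) v-stops

matching-row : ∀ {n} {M : EdgeSet n} → IsMatching M →
  ∀ a → IsRoot M a ⊎ ∃ λ b → lookup M a ≡ ⁅ b ⁆
matching-row {M = M} M-matching a with next M a in eq
... | nothing = inj₁ (next≡nothing⇒isRoot M eq)
... | just b = inj₂ (b , Matching.row≡⁅⁆ {M = M} M-matching (next-sound M eq))

sum-map-vec : ∀ {m} (g : A → ℕ) (xs : Vec A m) →
  Vec.sum (Vec.map g xs) ≡ sum (map (g ∘ lookup xs) (allFin m))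
sum-map-vec g xs = trans (sum-tabulate g xs) (cong sum (sym (map-tabulate (λ i → i) (g ∘ lookup xs))))
  where
  sum-tabulate : ∀ {m} (g : A → ℕ) (xs : Vec A m) →
    Vec.sum (Vec.map g xs) ≡ sum (tabulate (g ∘ lookup xs))
  sum-tabulate g [] = refl
  sum-tabulate g (x ∷ xs) = cong (g x +_) (sum-tabulate g xs)

sum-map-[]≔ : ∀ {m} (g : A → ℕ) (xs : Vec A m) i {y} → g y ≡ suc (g (lookup xs i)) →
  Vec.sum (Vec.map g (xs [ i ]≔ y)) ≡ suc (Vec.sum (Vec.map g xs))
sum-map-[]≔ g (x ∷ xs) zero gy≡1+gx = cong (_+ Vec.sum (Vec.map g xs)) gy≡1+gx
sum-map-[]≔ g (x ∷ xs) (suc i) gy≡1+gx = trans (cong (g x +_) (sum-map-[]≔ g xs i gy≡1+gx)) (+-suc (g x) _)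

length-filter-tabulate-suc : ∀ {m} {P : Pred (Fin (suc m)) 0ℓ} (P? : Decidable P) →
  length (filter P? (tabulate suc)) ≡ length (filter (P? ∘ suc) (allFin m))
length-filter-tabulate-suc {m} P? =
  trans (cong (length ∘ filter P?) (sym (map-tabulate (λ i → i) suc))) (length-filter-map P? suc (allFin m))

∣p∣≡length-filter : ∀ {m} (p : Subset m) →
  ∣ p ∣ ≡ length (filter (λ u → lookup p u Bool.≟ true) (allFin m))
∣p∣≡length-filter [] = refl
∣p∣≡length-filter (true ∷ p) = cong suc (trans (∣p∣≡length-filter p)
  (sym (length-filter-tabulate-suc (λ u → lookup (true ∷ p) u Bool.≟ true))))
∣p∣≡length-filter (false ∷ p) = trans (∣p∣≡length-filter p)
  (sym (length-filter-tabulate-suc (λ u → lookup (false ∷ p) u Bool.≟ true)))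

∣p∣≡0⇒p≡⊥ : ∀ {m} (p : Subset m) → ∣ p ∣ ≡ 0 → p ≡ ⊥
∣p∣≡0⇒p≡⊥ [] _ = refl
∣p∣≡0⇒p≡⊥ (false ∷ p) ∣p∣≡0 = cong (false ∷_) (∣p∣≡0⇒p≡⊥ p ∣p∣≡0)

-- Grafting and cutting

module _ {n : ℕ} where

  graft : EdgeSet n → Fin n → Fin n → EdgeSet n
  graft F ρ v = F [ ρ ]≔ ⁅ v ⁆

  cut : EdgeSet n → Fin n → EdgeSet n
  cut F ρ = F [ ρ ]≔ ⊥

  module _ (F : EdgeSet n) (ρ : Fin n) where

    size-graft : ∀ v → IsRoot F ρ → size (graft F ρ v) ≡ suc (size F)
    size-graft v ρ-root = sum-map-[]≔ ∣_∣ F ρ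
      (trans (∣⁅x⁆∣≡1 v) (cong suc (sym (trans (cong ∣_∣ ρ-root) (∣⊥∣≡0 n)))))

    cut-graft : ∀ {v} → IsRoot F ρ → cut (graft F ρ v) ρ ≡ F
    cut-graft ρ-root =
      trans ([]≔-idempotent F ρ) (trans (cong (F [ ρ ]≔_) (sym ρ-root)) ([]≔-lookup F ρ))

    graft-cut : ∀ {v} → lookup F ρ ≡ ⁅ v ⁆ → graft (cut F ρ) ρ v ≡ F
    graft-cut row≡⁅v⁆ =
      trans ([]≔-idempotent F ρ) (trans (cong (F [ ρ ]≔_) (sym row≡⁅v⁆)) ([]≔-lookup F ρ))

    cut-isRoot : IsRoot (cut F ρ) ρ
    cut-isRoot = lookup∘update ρ F ⊥

    cut-⊆ : cut F ρ ⊆E F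
    cut-⊆ {a , b} ab∈cut with a Fin.≟ ρ
    ... | yes refl = ⊥-elim (isRoot⇒∉E (cut F ρ) cut-isRoot ab∈cut)
    ... | no a≢ρ = trans (cong (λ p → lookup p b) (sym (lookup∘update′ a≢ρ F ⊥))) ab∈cut

    module GraftEdges (v : Fin n) where

      ∈E-graft⁻ : ∀ {a b} → (a , b) ∈E graft F ρ v → (a ≡ ρ × b ≡ v) ⊎ (a ≢ ρ × (a , b) ∈E F)
      ∈E-graft⁻ {a} {b} ab∈F′ with a Fin.≟ ρ
      ... | yes refl = inj₁ (refl , x∈⁅y⁆⇒x≡y v (lookup⇒[]= b _
        (trans (cong (λ p → lookup p b) (sym (lookup∘update ρ F ⁅ v ⁆))) ab∈F′)))
      ... | no a≢ρ =
        inj₂ (a≢ρ , trans (cong (λ p → lookup p b) (sym (lookup∘update′ a≢ρ F ⁅ v ⁆))) ab∈F′)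

      ρv∈graft : (ρ , v) ∈E graft F ρ v
      ρv∈graft = trans (cong (λ p → lookup p v) (lookup∘update ρ F ⁅ v ⁆)) ([]=⇒lookup (x∈⁅x⁆ v))

      next-graft-ρ : next (graft F ρ v) ρ ≡ just v
      next-graft-ρ = trans (cong firstTrue (lookup∘update ρ F ⁅ v ⁆)) (firstTrue-⁅⁆ v)

      next-graft-≢ : ∀ {a} → a ≢ ρ → next (graft F ρ v) a ≡ next F a
      next-graft-≢ a≢ρ = cong firstTrue (lookup∘update′ a≢ρ F ⁅ v ⁆)

      walk-graft-avoiding : ∀ {x} → (∀ j → walk F j x ≢ just ρ) →
        ∀ k → walk (graft F ρ v) k x ≡ walk F k x
      walk-graft-avoiding avoids zero = refl
      walk-graft-avoiding {nothing} avoids (suc k) = trans (walk-nothing _ k) (sym (walk-nothing F k))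
      walk-graft-avoiding {just w} avoids (suc k) =
        trans (cong (walk (graft F ρ v) k) (next-graft-≢ (avoids 0 ∘ cong just)))
              (walk-graft-avoiding (avoids ∘ suc) k)

module Graft {n : ℕ} {F : EdgeSet n} (F-acyclicMatching : IsAcyclicMatching F)
             {ρ v : Fin n} (ρ-root : IsRoot F ρ) (v↛ρ : rootOf F v ≢ ρ) where

  private
    F-matching : IsMatching F
    F-matching = proj₁ F-acyclicMatching
    F-stops : ∀ w → walk F n (just w) ≡ nothing
    F-stops = acyclic⇒walk-n≡nothing F-matching (proj₂ F-acyclicMatching)
    F′ : EdgeSet n
    F′ = graft F ρ v
    module F = Matching {M = F} F-matching

  open GraftEdges F ρ v

  v-avoids-ρ : ∀ j → walk F j (just v) ≢ just ρ
  v-avoids-ρ j reach = v↛ρ (rootOf-unique F (F-stops v) {j} reach ρ-root)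

  graft-isMatching : IsMatching F′
  graft-isMatching = isMatching {M = F′} irreflexive functional asymmetric
    where
    v≢ρ : v ≢ ρ
    v≢ρ = v-avoids-ρ 0 ∘ cong just
    vρ∉F : ¬ (v , ρ) ∈E F
    vρ∉F = v-avoids-ρ 1 ∘ next-complete F F-matching
    irreflexive : ∀ {a b} → (a , b) ∈E F′ → a ≢ b
    irreflexive ab∈F′ with ∈E-graft⁻ ab∈F′
    ... | inj₁ (refl , refl) = v≢ρ ∘ sym
    ... | inj₂ (_ , ab∈F) = F.irreflexive ab∈F
    functional : ∀ {a b c} → (a , b) ∈E F′ → (a , c) ∈E F′ → b ≡ c
    functional ab∈F′ ac∈F′ with ∈E-graft⁻ ab∈F′ | ∈E-graft⁻ ac∈F′
    ... | inj₁ (_ , refl) | inj₁ (_ , refl) = refl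
    ... | inj₁ (refl , _) | inj₂ (a≢ρ , _) = ⊥-elim (a≢ρ refl)
    ... | inj₂ (a≢ρ , _) | inj₁ (refl , _) = ⊥-elim (a≢ρ refl)
    ... | inj₂ (_ , ab∈F) | inj₂ (_ , ac∈F) = F.functional ab∈F ac∈F
    asymmetric : ∀ {a b} → (a , b) ∈E F′ → ¬ (b , a) ∈E F′
    asymmetric ab∈F′ ba∈F′ with ∈E-graft⁻ ab∈F′ | ∈E-graft⁻ ba∈F′
    ... | inj₁ (refl , refl) | inj₁ (v≡ρ , _) = v≢ρ v≡ρ
    ... | inj₁ (refl , refl) | inj₂ (_ , vρ∈F) = vρ∉F vρ∈F
    ... | inj₂ (_ , vρ∈F) | inj₁ (refl , refl) = vρ∉F vρ∈F
    ... | inj₂ (_ , ab∈F) | inj₂ (_ , ba∈F) = F.asymmetric ab∈F ba∈F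

  -- A walk of the grafted forest that reaches ρ continues at v, whose walk in F never meets ρ.
  graft-terminating : Terminating F′
  graft-terminating w = terminates n w (F-stops w)
    where
    terminates : ∀ k w → walk F k (just w) ≡ nothing → ∃ λ k′ → walk F′ k′ (just w) ≡ nothing
    terminates (suc k) w stops with w Fin.≟ ρ
    ... | yes refl =
      suc n , trans (cong (walk F′ n) next-graft-ρ) (trans (walk-graft-avoiding v-avoids-ρ n) (F-stops v))
    ... | no w≢ρ with next F w in eq
    ...   | nothing = 1 , trans (next-graft-≢ w≢ρ) eq
    ...   | just u with k′ , stops′ ← terminates k u stops =
      suc k′ , trans (cong (walk F′ k′) (trans (next-graft-≢ w≢ρ) eq)) stops′

  graft-isAcyclicMatching : IsAcyclicMatching F′
  graft-isAcyclicMatching = graft-isMatching , terminating⇒acyclic graft-isMatching graft-terminating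

module Cut {n : ℕ} {F′ : EdgeSet n} (F′-acyclicMatching : IsAcyclicMatching F′)
           {ρ v : Fin n} (ρv∈F′ : (ρ , v) ∈E F′) where

  private
    F′-matching : IsMatching F′
    F′-matching = proj₁ F′-acyclicMatching
    F : EdgeSet n
    F = cut F′ ρ

  cut-isAcyclicMatching : IsAcyclicMatching F
  cut-isAcyclicMatching = acyclicMatching-⊆ (cut-⊆ F′ ρ) F′-acyclicMatching

  graft-of-cut : graft F ρ v ≡ F′
  graft-of-cut = graft-cut F′ ρ (Matching.row≡⁅⁆ {M = F′} F′-matching ρv∈F′)

  size-cut : size F′ ≡ suc (size F)
  size-cut = trans (cong size (sym graft-of-cut)) (size-graft F ρ v (cut-isRoot F′ ρ))

  rootOf-cut : rootOf F v ≢ ρ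
  rootOf-cut root≡ρ with j , reach ← follow-reachable F n v =
    acyclic⇒no-walk-cycle F′-matching (proj₂ F′-acyclicMatching) j (begin
      walk F′ (suc j) (just ρ) ≡⟨ cong (walk F′ j) (next-complete F′ F′-matching ρv∈F′) ⟩
      walk F′ j (just v)       ≡⟨ walk-⊑-just (next-⊆ {M = F} {F′} F′-matching (cut-⊆ F′ ρ)) j reach ⟩
      just (rootOf F v)        ≡⟨ cong just root≡ρ ⟩
      just ρ                   ∎)
    where open ≡-Reasoning

-- The recurrence

nC[1+k]*[1+k]≡nCk*[n∸k] : ∀ n k → (n C suc k) * suc k ≡ (n C k) * (n ∸ k)
nC[1+k]*[1+k]≡nCk*[n∸k] zero k = trans (cong (_* suc k) (k>n⇒nCk≡0 {0} {suc k} (s≤s z≤n)))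
  (sym (trans (cong ((0 C k) *_) (0∸n≡0 k)) (*-zeroʳ (0 C k))))
nC[1+k]*[1+k]≡nCk*[n∸k] (suc n) zero rewrite nC1≡n (suc n) =
  trans (*-identityʳ (suc n)) (sym (+-identityʳ (suc n)))
nC[1+k]*[1+k]≡nCk*[n∸k] (suc n) (suc k) = begin
  (suc n C suc (suc k)) * suc (suc k)
    ≡⟨ cong (_* suc (suc k)) (nCk+nC[k+1]≡[n+1]C[k+1] n (suc k)) ⟨
  (c + n C suc (suc k)) * suc (suc k)
    ≡⟨ *-distribʳ-+ (suc (suc k)) c _ ⟩
  c * suc (suc k) + (n C suc (suc k)) * suc (suc k)
    ≡⟨ cong (c * suc (suc k) +_) (nC[1+k]*[1+k]≡nCk*[n∸k] n (suc k)) ⟩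
  c * suc (suc k) + c * (n ∸ suc k)
    ≡⟨ *-distribˡ-+ c (suc (suc k)) (n ∸ suc k) ⟨
  c * (suc (suc k) + (n ∸ suc k))
    ≡⟨ sameTotal ⟩
  c * (suc k + (n ∸ k))
    ≡⟨ *-distribˡ-+ c (suc k) (n ∸ k) ⟩
  c * suc k + c * (n ∸ k)
    ≡⟨ cong (_+ c * (n ∸ k)) (nC[1+k]*[1+k]≡nCk*[n∸k] n k) ⟩
  (n C k) * (n ∸ k) + c * (n ∸ k)
    ≡⟨ *-distribʳ-+ (n ∸ k) (n C k) c ⟨
  (n C k + c) * (n ∸ k)
    ≡⟨ cong (_* (n ∸ k)) (nCk+nC[k+1]≡[n+1]C[k+1] n k) ⟩
  (suc n C suc k) * (suc n ∸ suc k)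
    ∎
  where
  open ≡-Reasoning
  c : ℕ
  c = n C suc k
  sameTotal : c * (suc (suc k) + (n ∸ suc k)) ≡ c * (suc k + (n ∸ k))
  sameTotal with suc k ≤? n
  ... | yes k<n = cong (λ m → c * suc m) (trans (m+[n∸m]≡n k<n) (sym (m+[n∸m]≡n (<⇒≤ k<n))))
  ... | no k≮n rewrite k>n⇒nCk≡0 (≰⇒> k≮n) = refl

faceNumber : ℕ → ℕ → ℕ
faceNumber n i = (n C i) * (n ∸ i) * n ^ (i ∸ 1)

faceNumber-step : ∀ n j →
  faceNumber n (suc (suc j)) * suc (suc j) ≡ faceNumber n (suc j) * (n * (n ∸ suc j ∸ 1))
faceNumber-step n j = begin
  c₂ * b * (n * p) * s
    ≡⟨ solve 5 (λ c₂ b n p s → c₂ :* b :* (n :* p) :* s := c₂ :* s :* (b :* n :* p)) refl c₂ b n p s ⟩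
  c₂ * s * (b * n * p)
    ≡⟨ cong (_* (b * n * p)) (nC[1+k]*[1+k]≡nCk*[n∸k] n (suc j)) ⟩
  c₁ * a * (b * n * p)
    ≡⟨ solve 5 (λ c₁ a b n p → c₁ :* a :* (b :* n :* p) := c₁ :* a :* p :* (n :* b)) refl c₁ a b n p ⟩
  c₁ * a * p * (n * b)
    ≡⟨ cong (λ m → c₁ * a * p * (n * m)) b≡n∸[1+j]∸1 ⟩
  c₁ * a * p * (n * (n ∸ suc j ∸ 1))
    ∎
  where
  open ≡-Reasoning
  open +-*-Solver using (solve; _:=_; _:*_)
  c₁ c₂ a b p s : ℕ
  c₁ = n C suc j
  c₂ = n C suc (suc j)
  a = n ∸ suc j
  b = n ∸ suc (suc j)
  p = n ^ j
  s = suc (suc j)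
  b≡n∸[1+j]∸1 : b ≡ n ∸ suc j ∸ 1
  b≡n∸[1+j]∸1 = trans (cong (n ∸_) (+-comm 1 (suc j))) (sym (∸-+-assoc n (suc j) 1))

faceNumber-recurrence : ∀ n (A : ℕ → ℕ) → A 0 ≡ 1 →
  (∀ i → A (suc i) * suc i ≡ A i * (n * (n ∸ i ∸ 1))) → ∀ j → A (suc j) ≡ faceNumber n (suc j)
faceNumber-recurrence n A A0≡1 step zero = begin
  A 1                   ≡⟨ *-identityʳ (A 1) ⟨
  A 1 * 1               ≡⟨ step 0 ⟩
  A 0 * (n * (n ∸ 1))   ≡⟨ cong (_* (n * (n ∸ 1))) A0≡1 ⟩
  1 * (n * (n ∸ 1))     ≡⟨ *-identityˡ _ ⟩
  n * (n ∸ 1)           ≡⟨ cong (_* (n ∸ 1)) (nC1≡n n) ⟨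
  (n C 1) * (n ∸ 1)     ≡⟨ *-identityʳ _ ⟨
  faceNumber n 1        ∎
  where open ≡-Reasoning
faceNumber-recurrence n A A0≡1 step (suc j) = *-cancelʳ-≡ _ _ (suc (suc j)) (begin
  A (suc (suc j)) * suc (suc j)
    ≡⟨ step (suc j) ⟩
  A (suc j) * (n * (n ∸ suc j ∸ 1))
    ≡⟨ cong (_* (n * (n ∸ suc j ∸ 1))) (faceNumber-recurrence n A A0≡1 step j) ⟩
  faceNumber n (suc j) * (n * (n ∸ suc j ∸ 1))
    ≡⟨ faceNumber-step n j ⟨
  faceNumber n (suc (suc j)) * suc (suc j)
    ∎)
  where open ≡-Reasoning

-- Double counting

module _ {n : ℕ} where

  ∅ : EdgeSet n
  ∅ = replicate n ⊥

  ∉E-∅ : ∀ {e} → ¬ e ∈E ∅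
  ∉E-∅ {a , b} =
    Bool.not-¬ (trans (cong (λ p → lookup p b) (lookup-replicate a ⊥)) (lookup-replicate b false))

  ∅-isAcyclicMatching : IsAcyclicMatching ∅
  ∅-isAcyclicMatching =
    ∅-matching , terminating⇒acyclic ∅-matching (λ w → 1 , isRoot⇒next≡nothing ∅ (lookup-replicate w ⊥))
    where
    ∅-matching : IsMatching ∅
    ∅-matching = (λ _ → ⊥-elim ∘ ∉E-∅) , (λ _ _ → ⊥-elim ∘ ∉E-∅)

  size-∅ : size ∅ ≡ 0
  size-∅ = trans (sum-map-vec ∣_∣ ∅)
    (trans (sum-map-const _ (allFin n) ∣row∣≡0) (*-zeroʳ (length (allFin n))))
    where
    ∣row∣≡0 : ∀ ρ → ∣ lookup ∅ ρ ∣ ≡ 0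
    ∣row∣≡0 ρ = trans (cong ∣_∣ (lookup-replicate ρ ⊥)) (∣⊥∣≡0 n)

  size≡0⇒≡∅ : ∀ {M : EdgeSet n} → size M ≡ 0 → M ≡ ∅
  size≡0⇒≡∅ = rows≡⊥ _
    where
    rows≡⊥ : ∀ {m} (M : Vec (Subset n) m) → Vec.sum (Vec.map ∣_∣ M) ≡ 0 → M ≡ replicate m ⊥
    rows≡⊥ [] _ = refl
    rows≡⊥ (p ∷ M) sum≡0 =
      cong₂ _∷_ (∣p∣≡0⇒p≡⊥ p (m+n≡0⇒m≡0 ∣ p ∣ sum≡0))
                (rows≡⊥ M (m+n≡0⇒n≡0 ∣ p ∣ sum≡0))

module _ {n : ℕ} (F : EdgeSet n) where

  #roots : ℕ
  #roots = length (filter (isRoot? F) (allFin n))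

  #roots+size : IsMatching F → #roots + size F ≡ n
  #roots+size F-matching = begin
    #roots + size F
      ≡⟨ cong (#roots +_) (sum-map-vec ∣_∣ F) ⟩
    #roots + sum (map (∣_∣ ∘ lookup F) (allFin n))
      ≡⟨ length-filter+sum (isRoot? F) _ (allFin n) rootOrEdge ⟩
    length (allFin n)
      ≡⟨ length-allFin n ⟩
    n ∎
    where
    open ≡-Reasoning
    ∣row∣≡0 : ∀ {ρ} → IsRoot F ρ → ∣ lookup F ρ ∣ ≡ 0
    ∣row∣≡0 ρ-root = trans (cong ∣_∣ ρ-root) (∣⊥∣≡0 n)
    rootOrEdge : ∀ ρ → (IsRoot F ρ × ∣ lookup F ρ ∣ ≡ 0) ⊎ (¬ IsRoot F ρ × ∣ lookup F ρ ∣ ≡ 1)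
    rootOrEdge ρ with matching-row {M = F} F-matching ρ
    ... | inj₁ ρ-root = inj₁ (ρ-root , ∣row∣≡0 ρ-root)
    ... | inj₂ (b , row≡⁅b⁆) =
      inj₂ ((λ ρ-root → 0≢1+n (trans (sym (∣row∣≡0 ρ-root)) ∣row∣≡1)) , ∣row∣≡1)
      where
      ∣row∣≡1 : ∣ lookup F ρ ∣ ≡ 1
      ∣row∣≡1 = trans (cong ∣_∣ row≡⁅b⁆) (∣⁅x⁆∣≡1 b)

  size≡#edges : size F ≡ length (filter (_∈E? F) (cartesianProduct (allFin n) (allFin n)))
  size≡#edges = begin
    size F
      ≡⟨ sum-map-vec ∣_∣ F ⟩
    sum (map (∣_∣ ∘ lookup F) (allFin n))
      ≡⟨ cong sum (map-cong (∣p∣≡length-filter ∘ lookup F) (allFin n)) ⟩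
    sum (map (λ a → length (filter (λ b → (a , b) ∈E? F) (allFin n))) (allFin n))
      ≡⟨ length-filter-cartesianProductWith (_∈E? F) _,_ (allFin n) (allFin n) ⟨
    length (filter (_∈E? F) (cartesianProduct (allFin n) (allFin n)))
      ∎
    where open ≡-Reasoning

  Graftable : Fin n × Fin n → Set
  Graftable (v , ρ) = IsRoot F ρ × rootOf F v ≢ ρ

  graftable? : Decidable Graftable
  graftable? (v , ρ) = isRoot? F ρ ×-dec ¬? (rootOf F v Fin.≟ ρ)

  #graftable : ∀ {i} → IsAcyclicMatching F → size F ≡ i →
    length (filter graftable? (cartesianProduct (allFin n) (allFin n))) ≡ n * (n ∸ i ∸ 1)
  #graftable {i} (F-matching , F-acyclic) size≡i = begin
    length (filter graftable? (cartesianProduct (allFin n) (allFin n)))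
      ≡⟨ length-filter-cartesianProductWith graftable? _,_ (allFin n) (allFin n) ⟩
    sum (map (λ v → length (filter (graftable? ∘ (v ,_)) (allFin n))) (allFin n))
      ≡⟨ sum-map-const _ (allFin n) #graftable-from ⟩
    length (allFin n) * (n ∸ i ∸ 1)
      ≡⟨ cong (_* (n ∸ i ∸ 1)) (length-allFin n) ⟩
    n * (n ∸ i ∸ 1) ∎
    where
    open ≡-Reasoning
    #roots≡n∸i : #roots ≡ n ∸ i
    #roots≡n∸i = trans (sym (m+n∸n≡m #roots i))
      (cong (_∸ i) (trans (cong (#roots +_) (sym size≡i)) (#roots+size F-matching)))
    #graftable-from : ∀ v → length (filter (graftable? ∘ (v ,_)) (allFin n)) ≡ n ∸ i ∸ 1
    #graftable-from v = cong (_∸ 1) (trans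
      (length-filter-≢ (isRoot? F) Fin._≟_ (allFin n) (Unique.allFin⁺ n) (∈-allFin (rootOf F v))
        (rootOf-isRoot F (acyclic⇒walk-n≡nothing F-matching F-acyclic v)))
      #roots≡n∸i)

module Counting (n : ℕ) where

  Triple : Set
  Triple = EdgeSet n × Fin n × Fin n

  triples : List Triple
  triples = cartesianProduct (allEdgeSets n) (cartesianProduct (allFin n) (allFin n))

  triples! : Unique triples
  triples! = Unique.cartesianProduct⁺ (allEdgeSets! n)
    (Unique.cartesianProduct⁺ (Unique.allFin⁺ n) (Unique.allFin⁺ n))

  ∈-triples : ∀ t → t ∈ triples
  ∈-triples (F , a , b) =
    ∈-cartesianProduct⁺ (∈-allEdgeSets F) (∈-cartesianProduct⁺ (∈-allFin a) (∈-allFin b))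

  acyclicMatchingOfSize? : ∀ i → Decidable (λ (M : EdgeSet n) → IsAcyclicMatching M × size M ≡ i)
  acyclicMatchingOfSize? i M = isAcyclicMatching? M ×-dec (size M ≟ i)

  acyclicMatchings : ℕ → List (EdgeSet n)
  acyclicMatchings i = filter (acyclicMatchingOfSize? i) (allEdgeSets n)

  #acyclicMatchings : ℕ → ℕ
  #acyclicMatchings i = length (acyclicMatchings i)

  acyclicMatchings! : ∀ i → Unique (acyclicMatchings i)
  acyclicMatchings! i = Unique.filter⁺ (acyclicMatchingOfSize? i) (allEdgeSets! n)

  ∈-acyclicMatchings : ∀ {i M} → M ∈ acyclicMatchings i ⇔ (IsAcyclicMatching M × size M ≡ i)
  ∈-acyclicMatchings {i} {M} = mk⇔
    (proj₂ ∘ ∈-filter⁻ (acyclicMatchingOfSize? i) {xs = allEdgeSets n})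
    (∈-filter⁺ (acyclicMatchingOfSize? i) (∈-allEdgeSets M))

  -- A triple (F , a , b) stands for (F , v , ρ) in grafts and for (F′ , ρ , v) in cuts, so that the
  -- inner count runs over the roots ρ for fixed v, resp. over the edges (ρ , v) of F′ for fixed ρ.
  grafts : ℕ → List Triple
  grafts i = filter (λ (F , p) → acyclicMatchingOfSize? i F ×-dec graftable? F p) triples

  cuts : ℕ → List Triple
  cuts i = filter (λ (F′ , e) → acyclicMatchingOfSize? (suc i) F′ ×-dec (e ∈E? F′)) triples

  #grafts : ∀ i → length (grafts i) ≡ #acyclicMatchings i * (n * (n ∸ i ∸ 1))
  #grafts i = length-filter-cartesianProduct-× (acyclicMatchingOfSize? i) graftable? (allEdgeSets n) _
    (λ F (F-acyclicMatching , size≡i) → #graftable F F-acyclicMatching size≡i)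

  #cuts : ∀ i → length (cuts i) ≡ #acyclicMatchings (suc i) * suc i
  #cuts i =
    length-filter-cartesianProduct-× (acyclicMatchingOfSize? (suc i)) (λ F′ → _∈E? F′) (allEdgeSets n) _
      (λ F′ (_ , size≡1+i) → trans (sym (size≡#edges F′)) size≡1+i)

  graftTriple : Triple → Triple
  graftTriple (F , v , ρ) = graft F ρ v , ρ , v

  cutTriple : Triple → Triple
  cutTriple (F′ , ρ , v) = cut F′ ρ , v , ρ

  #grafts≡#cuts : ∀ i → length (grafts i) ≡ length (cuts i)
  #grafts≡#cuts i = length-≡-bijection graftTriple cutTriple (grafts i) (cuts i)
    (Unique.filter⁺ _ triples!) (Unique.filter⁺ _ triples!) graft∈cuts cut∈grafts cut∘graft graft∘cut
    where
    graftable : ∀ {F v ρ} → (F , v , ρ) ∈ grafts i →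
      (IsAcyclicMatching F × size F ≡ i) × IsRoot F ρ × rootOf F v ≢ ρ
    graftable = proj₂ ∘ ∈-filter⁻ _ {xs = triples}
    cuttable : ∀ {F′ ρ v} → (F′ , ρ , v) ∈ cuts i →
      (IsAcyclicMatching F′ × size F′ ≡ suc i) × (ρ , v) ∈E F′
    cuttable = proj₂ ∘ ∈-filter⁻ _ {xs = triples}
    graft∈cuts : ∀ {t} → t ∈ grafts i → graftTriple t ∈ cuts i
    graft∈cuts {F , v , ρ} t∈ with (F-acyclicMatching , size≡i) , ρ-root , v↛ρ ← graftable t∈ =
      ∈-filter⁺ _ (∈-triples _)
        ((Graft.graft-isAcyclicMatching F-acyclicMatching ρ-root v↛ρ ,
          trans (size-graft F ρ v ρ-root) (cong suc size≡i)) ,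
         GraftEdges.ρv∈graft F ρ v)
    cut∈grafts : ∀ {t} → t ∈ cuts i → cutTriple t ∈ grafts i
    cut∈grafts {F′ , ρ , v} t∈ with (F′-acyclicMatching , size≡1+i) , ρv∈F′ ← cuttable t∈ =
      ∈-filter⁺ _ (∈-triples _)
        ((Cut.cut-isAcyclicMatching F′-acyclicMatching ρv∈F′ ,
          suc-injective (trans (sym (Cut.size-cut F′-acyclicMatching ρv∈F′)) size≡1+i)) ,
         cut-isRoot F′ ρ , Cut.rootOf-cut F′-acyclicMatching ρv∈F′)
    cut∘graft : ∀ {t} → t ∈ grafts i → cutTriple (graftTriple t) ≡ t
    cut∘graft {F , v , ρ} t∈ = cong (_, v , ρ) (cut-graft F ρ (proj₁ (proj₂ (graftable t∈))))
    graft∘cut : ∀ {t} → t ∈ cuts i → graftTriple (cutTriple t) ≡ t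
    graft∘cut {F′ , ρ , v} t∈ =
      cong (_, ρ , v) (Cut.graft-of-cut (proj₁ (proj₁ (cuttable t∈))) (proj₂ (cuttable t∈)))

  #acyclicMatchings-recurrence : ∀ i →
    #acyclicMatchings (suc i) * suc i ≡ #acyclicMatchings i * (n * (n ∸ i ∸ 1))
  #acyclicMatchings-recurrence i = trans (sym (#cuts i)) (trans (sym (#grafts≡#cuts i)) (#grafts i))

  #acyclicMatchings-0 : #acyclicMatchings 0 ≡ 1
  #acyclicMatchings-0 =
    length-≡-bijection (λ M → M) (λ M → M) (acyclicMatchings 0) (∅ ∷ []) (acyclicMatchings! 0) ([] ∷ [])
      (λ M∈ → here (size≡0⇒≡∅ (proj₂ (Equivalence.to ∈-acyclicMatchings M∈))))
      (λ { (here refl) → Equivalence.from ∈-acyclicMatchings (∅-isAcyclicMatching , size-∅ {n}) })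
      (λ _ → refl) (λ _ → refl)

mainTheorem2 : ∀ (n i : ℕ) → 1 ≤ i → i ≤ n →
    Σ (List (EdgeSet n)) (λ L →
      Unique L ×
      (∀ (M : EdgeSet n) → (M ∈ L) ⇔ (IsAcyclicMatching M × size M ≡ i)) ×
      length L ≡ (n C i) * (n ∸ i) * n ^ (i ∸ 1))
mainTheorem2 n (suc j) (s≤s z≤n) _ =
  acyclicMatchings (suc j) , acyclicMatchings! (suc j) , (λ _ → ∈-acyclicMatchings) ,
  faceNumber-recurrence n #acyclicMatchings #acyclicMatchings-0 #acyclicMatchings-recurrence j
  where open Counting n
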